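{- For all integers $n \geq d \geq 1$, with the convention $j_0=0$, $$d!\sum_{1\leq i_1\leq i_2\leq \cdots\leq i_{n-d}\leq d} i_1 i_2\cdots i_{n-d} \;=\; \sum_{1\leq j_1<j_2<\cdots<j_{d-1}< n} 1\cdot 2^{j_{d-1}-j_{d-2}}\cdot 3^{j_{d-2}-j_{d-3}}\cdots d^{\,j_1},$$ where the right-hand side is $\sum_{1\leq j_1<\cdots<j_{d-1}<n}\prod_{r=2}^{d} r^{\,j_{d-r+1}-j_{d-r}}$.
   Context: When $n=d$ the left-hand sum is over the empty tuple and equals $1$ (times $d!$); when $d=1$ the right-hand sum consists of the single term $1$. -}

module Defs where

open import Data.Nat using (ℕ; zero; suc; _+_; _*_; _∸_; _^_; _≤_; _<_; _≤?_; _<?_)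
open import Data.List using (List; []; _∷_; map; concatMap; filter; length; upTo)
open import Data.Nat.ListAction using (sum; product)
open import Data.List.Relation.Unary.Linked using (Linked)
import Data.List.Relation.Unary.Linked as Linked
open import Data.Nat using (_!)

range : ℕ → ℕ → List ℕ
range a b = map (a +_) (upTo (suc b ∸ a))

tuples : ℕ → ℕ → ℕ → List (List ℕ)
tuples zero    a b = [] ∷ []
tuples (suc m) a b = concatMap (λ x → map (x ∷_) (tuples m a b)) (range a b)

weakIncr : ℕ → ℕ → ℕ → List (List ℕ)
weakIncr m a b = filter (Linked.linked? _≤?_) (tuples m a b)

strictIncr : ℕ → ℕ → ℕ → List (List ℕ)
strictIncr m a b = filter (Linked.linked? _<?_) (tuples m a b)

lhs : ℕ → ℕ → ℕ
lhs n d = (d !) * sum (map product (weakIncr (n ∸ d) 1 d))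

-- For j = (j₁,…,j_{d-1}) (with j₀ = 0), the term ∏_{r=2}^{d} r^(j_{d-r+1} - j_{d-r}).
-- Index convention: jAt js k = j_k for 1 ≤ k ≤ length js, and jAt js 0 = 0.
jAt : List ℕ → ℕ → ℕ
jAt js zero = 0
jAt [] (suc k) = 0
jAt (x ∷ js) (suc zero) = x
jAt (x ∷ js) (suc (suc k)) = jAt js (suc k)

rhsTerm : ℕ → List ℕ → ℕ
rhsTerm d js = product (map (λ r → r ^ (jAt js (d ∸ r + 1) ∸ jAt js (d ∸ r))) (range 2 d))

rhs : ℕ → ℕ → ℕ
rhs n d = sum (map (rhsTerm d) (strictIncr (d ∸ 1) 1 (n ∸ 1)))

{-# OPTIONS --safe #-}
-- Both sides count the surjections from an n-set onto a d-set, d! S(n,d).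
-- On the left, the weakly increasing products sum to the complete homogeneous
-- polynomial h_m(1,…,d) with m = n - d; peeling off the largest variable d gives
-- d! h_{m+1}(1..d) = d (d! h_m(1..d) + (d-1)! h_{m+1}(1..d-1)), the recurrence of
-- surjections. On the right, summing over the first jump j₁ = y leaves a sum of
-- the same shape one level down, and the geometric weights d^{j₁} unroll exactly
-- the same recurrence.
module Submission where

open import Defs
open import Data.Bool using (Bool; true; false; _∧_; if_then_else_)
open import Data.List using (List; []; _∷_; _++_; _∷ʳ_; [_]; map; concatMap; filter; applyUpTo)
open import Data.List.Properties using (map-cong; map-∘; map-++; map-applyUpTo)
open import Data.Nat using (ℕ; zero; suc; _+_; _*_; _∸_; _^_; _≤_; _<_; s≤s; s≤s⁻¹; z≤n; _≤?_; _<?_; _!)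
open import Data.Nat.ListAction using (sum; product)
open import Data.Nat.ListAction.Properties using (sum-++; product-++)
open import Data.Nat.Properties
open import Data.Nat.Tactic.RingSolver using (solve-∀)
open import Data.Product using (_,_)
open import Data.Sum using (inj₁; inj₂)
import Data.List.Relation.Unary.Linked as Linked
open import Relation.Nullary using (Dec; does)
open import Relation.Nullary.Decidable using (dec-true; dec-false)
open import Relation.Unary using (Pred; Decidable)
open import Relation.Binary.PropositionalEquality using (_≡_; refl; sym; trans; cong; cong₂; module ≡-Reasoning)
open ≡-Reasoning

sum-filter : ∀ {a p} {A : Set a} {P : Pred A p} (P? : Decidable P) (f : A → ℕ) (xs : List A) →
             sum (map f (filter P? xs)) ≡ sum (map (λ x → if does (P? x) then f x else 0) xs)
sum-filter P? f []       = refl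
sum-filter P? f (x ∷ xs) with does (P? x)
... | true  = cong (f x +_) (sum-filter P? f xs)
... | false = sum-filter P? f xs

sum-concatMap : ∀ {a b} {A : Set a} {B : Set b} (f : B → ℕ) (g : A → List B) (xs : List A) →
                sum (map f (concatMap g xs)) ≡ sum (map (λ x → sum (map f (g x))) xs)
sum-concatMap f g []       = refl
sum-concatMap f g (x ∷ xs) = begin
  sum (map f (g x ++ concatMap g xs))               ≡⟨ cong sum (map-++ f (g x) _) ⟩
  sum (map f (g x) ++ map f (concatMap g xs))       ≡⟨ sum-++ (map f (g x)) _ ⟩
  sum (map f (g x)) + sum (map f (concatMap g xs))  ≡⟨ cong (sum (map f (g x)) +_) (sum-concatMap f g xs) ⟩
  sum (map f (g x)) + sum (map (λ x → sum (map f (g x))) xs) ∎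

sum-map-*ˡ : ∀ {a} {A : Set a} c (f : A → ℕ) (xs : List A) →
             sum (map (λ x → c * f x) xs) ≡ c * sum (map f xs)
sum-map-*ˡ c f []       = sym (*-zeroʳ c)
sum-map-*ˡ c f (x ∷ xs) = trans (cong (c * f x +_) (sum-map-*ˡ c f xs)) (sym (*-distribˡ-+ c (f x) _))

sum-map-if : ∀ {a} {A : Set a} b (f : A → ℕ) (xs : List A) →
             sum (map (λ x → if b then f x else 0) xs) ≡ (if b then sum (map f xs) else 0)
sum-map-if true  f xs       = refl
sum-map-if false f []       = refl
sum-map-if false f (x ∷ xs) = sum-map-if false f xs

if-∧-* : ∀ b c u v → (if b ∧ c then u * v else 0) ≡ (if b then u * (if c then v else 0) else 0)
if-∧-* true  true  u v = refl
if-∧-* true  false u v = sym (*-zeroʳ u)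
if-∧-* false c     u v = refl

product-map-∷ʳ : ∀ {a} {A : Set a} (f : A → ℕ) (xs : List A) z →
                 product (map f (xs ∷ʳ z)) ≡ product (map f xs) * f z
product-map-∷ʳ f xs z = begin
  product (map f (xs ++ [ z ]))        ≡⟨ cong product (map-++ f xs [ z ]) ⟩
  product (map f xs ++ [ f z ])        ≡⟨ product-++ (map f xs) [ f z ] ⟩
  product (map f xs) * (f z * 1)       ≡⟨ cong (product (map f xs) *_) (*-identityʳ (f z)) ⟩
  product (map f xs) * f z             ∎

sum-tuples-suc : ∀ (F : List ℕ → ℕ) k a b →
                 sum (map F (tuples (suc k) a b))
                   ≡ sum (map (λ y → sum (map (λ t → F (y ∷ t)) (tuples k a b))) (range a b))
sum-tuples-suc F k a b =
  trans (sum-concatMap F (λ y → map (y ∷_) (tuples k a b)) (range a b))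
        (cong sum (map-cong (λ y → cong sum (sym (map-∘ (tuples k a b)))) (range a b)))

interval : ℕ → ℕ → List ℕ
interval a zero    = []
interval a (suc k) = a ∷ interval (suc a) k

applyUpTo≡interval : ∀ {f : ℕ → ℕ} {a} k → (∀ i → f i ≡ a + i) → applyUpTo f k ≡ interval a k
applyUpTo≡interval zero    f≡ = refl
applyUpTo≡interval {a = a} (suc k) f≡ =
  cong₂ _∷_ (trans (f≡ 0) (+-identityʳ a)) (applyUpTo≡interval k (λ i → trans (f≡ (suc i)) (+-suc a i)))

range≡interval : ∀ a b → range a b ≡ interval a (suc b ∸ a)
range≡interval a b = trans (map-applyUpTo (λ i → i) (a +_) (suc b ∸ a)) (applyUpTo≡interval _ (λ i → refl))

interval-∷ʳ : ∀ a k → interval a (suc k) ≡ interval a k ∷ʳ (a + k)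
interval-∷ʳ a zero    = cong [_] (sym (+-identityʳ a))
interval-∷ʳ a (suc k) = cong (a ∷_) (trans (interval-∷ʳ (suc a) k) (cong (interval (suc a) k ∷ʳ_) (sym (+-suc a k))))

map-interval-cong : ∀ {c} {C : Set c} {f g : ℕ → C} a k → (∀ y → a ≤ y → y < a + k → f y ≡ g y) →
                    map f (interval a k) ≡ map g (interval a k)
map-interval-cong a zero    f≡g = refl
map-interval-cong a (suc k) f≡g =
  cong₂ _∷_ (f≡g a ≤-refl (m<m+n a (s≤s z≤n)))
            (map-interval-cong (suc a) k (λ y a<y y<a+k → f≡g y (<⇒≤ a<y) (≤-trans y<a+k (≤-reflexive (sym (+-suc a k))))))

map-range-cong : ∀ {c} {C : Set c} {f g : ℕ → C} a b → (∀ y → a ≤ y → f y ≡ g y) →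
                 map f (range a b) ≡ map g (range a b)
map-range-cong {f = f} {g} a b f≡g = begin
  map f (range a b)                 ≡⟨ cong (map f) (range≡interval a b) ⟩
  map f (interval a (suc b ∸ a))    ≡⟨ map-interval-cong a _ (λ y a≤y _ → f≡g y a≤y) ⟩
  map g (interval a (suc b ∸ a))    ≡⟨ cong (map g) (range≡interval a b) ⟨
  map g (range a b)                 ∎

sum-interval-if-≤ : ∀ (g : ℕ → ℕ) a k {x} → a ≤ x →
                    sum (map (λ y → if does (x ≤? y) then g y else 0) (interval a k))
                      ≡ sum (map g (interval x (a + k ∸ x)))
sum-interval-if-≤ g a zero {x} a≤x =
  cong (λ c → sum (map g (interval x c))) (sym (m≤n⇒m∸n≡0 (≤-trans (≤-reflexive (+-identityʳ a)) a≤x)))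
sum-interval-if-≤ g a (suc k) {x} a≤x with m≤n⇒m<n∨m≡n a≤x
... | inj₁ a<x = begin
  (if does (x ≤? a) then g a else 0) + rest  ≡⟨ cong (λ c → (if c then g a else 0) + rest) (dec-false (x ≤? a) (<⇒≱ a<x)) ⟩
  rest                                       ≡⟨ sum-interval-if-≤ g (suc a) k a<x ⟩
  sum (map g (interval x (suc a + k ∸ x)))   ≡⟨ cong (λ c → sum (map g (interval x (c ∸ x)))) (+-suc a k) ⟨
  sum (map g (interval x (a + suc k ∸ x)))   ∎
  where rest = sum (map (λ y → if does (x ≤? y) then g y else 0) (interval (suc a) k))
... | inj₂ refl = begin
  sum (map (λ y → if does (a ≤? y) then g y else 0) (interval a (suc k)))
    ≡⟨ cong sum (map-interval-cong a (suc k) (λ y a≤y _ → cong (λ c → if c then g y else 0) (dec-true (a ≤? y) a≤y))) ⟩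
  sum (map g (interval a (suc k)))
    ≡⟨ cong (λ c → sum (map g (interval a c))) (m+n∸m≡n a (suc k)) ⟨
  sum (map g (interval a (a + suc k ∸ a))) ∎

completeHomogeneous : ℕ → List ℕ → ℕ
completeHomogeneous zero    xs       = 1
completeHomogeneous (suc m) []       = 0
completeHomogeneous (suc m) (x ∷ xs) = x * completeHomogeneous m (x ∷ xs) + completeHomogeneous (suc m) xs

completeHomogeneous-∷ʳ : ∀ m xs c →
  completeHomogeneous (suc m) (xs ∷ʳ c) ≡ c * completeHomogeneous m (xs ∷ʳ c) + completeHomogeneous (suc m) xs
completeHomogeneous-exchange : ∀ m a ys c →
  a * completeHomogeneous m (a ∷ (ys ∷ʳ c)) + c * completeHomogeneous m (ys ∷ʳ c)
    ≡ c * completeHomogeneous m (a ∷ (ys ∷ʳ c)) + a * completeHomogeneous m (a ∷ ys)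

completeHomogeneous-∷ʳ m []       c = refl
completeHomogeneous-∷ʳ m (a ∷ ys) c = begin
  a * H m L + H (suc m) (ys ∷ʳ c)                     ≡⟨ cong (a * H m L +_) (completeHomogeneous-∷ʳ m ys c) ⟩
  a * H m L + (c * H m (ys ∷ʳ c) + H (suc m) ys)      ≡⟨ +-assoc (a * H m L) _ _ ⟨
  a * H m L + c * H m (ys ∷ʳ c) + H (suc m) ys        ≡⟨ cong (_+ H (suc m) ys) (completeHomogeneous-exchange m a ys c) ⟩
  c * H m L + a * H m (a ∷ ys) + H (suc m) ys         ≡⟨ +-assoc (c * H m L) _ _ ⟩
  c * H m L + (a * H m (a ∷ ys) + H (suc m) ys)       ∎
  where
  H = completeHomogeneous
  L = a ∷ (ys ∷ʳ c)

completeHomogeneous-exchange zero    a ys c = +-comm (a * 1) (c * 1)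
completeHomogeneous-exchange (suc m) a ys c = begin
  a * H (suc m) L + c * Y                           ≡⟨ cong (λ z → a * z + c * Y) (completeHomogeneous-∷ʳ m (a ∷ ys) c) ⟩
  a * (c * H m L + H (suc m) (a ∷ ys)) + c * Y      ≡⟨ rearrange a c (H m L) Y (H (suc m) (a ∷ ys)) ⟩
  c * (a * H m L + Y) + a * H (suc m) (a ∷ ys)      ∎
  where
  H = completeHomogeneous
  L = a ∷ (ys ∷ʳ c)
  Y = H (suc m) (ys ∷ʳ c)
  rearrange : ∀ a c X Y Z → a * (c * X + Z) + c * Y ≡ c * (a * X + Y) + a * Z
  rearrange = solve-∀

completeHomogeneous-interval-last : ∀ m a k →
  completeHomogeneous (suc m) (interval a (suc k))
    ≡ (a + k) * completeHomogeneous m (interval a (suc k)) + completeHomogeneous (suc m) (interval a k)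
completeHomogeneous-interval-last m a k = begin
  H (suc m) (interval a (suc k))                                ≡⟨ cong (H (suc m)) (interval-∷ʳ a k) ⟩
  H (suc m) (I ∷ʳ (a + k))                                      ≡⟨ completeHomogeneous-∷ʳ m I (a + k) ⟩
  (a + k) * H m (I ∷ʳ (a + k)) + H (suc m) I                    ≡⟨ cong (λ xs → (a + k) * H m xs + H (suc m) I) (interval-∷ʳ a k) ⟨
  (a + k) * H m (interval a (suc k)) + H (suc m) I              ∎
  where
  H = completeHomogeneous
  I = interval a k

completeHomogeneous-interval-suffixes : ∀ m a k →
  completeHomogeneous (suc m) (interval a k)
    ≡ sum (map (λ y → y * completeHomogeneous m (interval y (a + k ∸ y))) (interval a k))
completeHomogeneous-interval-suffixes m a zero    = refl
completeHomogeneous-interval-suffixes m a (suc k) = begin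
  a * H m (interval a (suc k)) + H (suc m) (interval (suc a) k)
    ≡⟨ cong₂ _+_ (cong (λ c → a * H m (interval a c)) (sym (m+n∸m≡n a (suc k))))
                 (completeHomogeneous-interval-suffixes m (suc a) k) ⟩
  a * H m (interval a (a + suc k ∸ a)) + sum (map (λ y → y * H m (interval y (suc a + k ∸ y))) (interval (suc a) k))
    ≡⟨ cong (λ c → a * H m (interval a (a + suc k ∸ a)) + sum (map (λ y → y * H m (interval y (c ∸ y))) (interval (suc a) k)))
            (+-suc a k) ⟨
  a * H m (interval a (a + suc k ∸ a)) + sum (map (λ y → y * H m (interval y (a + suc k ∸ y))) (interval (suc a) k))
    ∎
  where H = completeHomogeneous

surjections : ℕ → ℕ → ℕ
surjections zero    zero    = 1
surjections zero    (suc d) = 0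
surjections (suc n) zero    = 0
surjections (suc n) (suc d) = suc d * (surjections n (suc d) + surjections n d)

surjections-< : ∀ {n d} → n < d → surjections n d ≡ 0
surjections-< {zero}  {suc d} _         = refl
surjections-< {suc n} {suc d} (s≤s n<d) =
  trans (cong₂ (λ u v → suc d * (u + v)) (surjections-< (m<n⇒m<1+n n<d)) (surjections-< n<d)) (*-zeroʳ (suc d))

surjections-onto-1 : ∀ n → surjections (suc n) 1 ≡ 1
surjections-onto-1 zero    = refl
surjections-onto-1 (suc n) = trans (*-identityˡ _) (trans (+-identityʳ _) (surjections-onto-1 n))

surjections≡!*completeHomogeneous : ∀ d m → surjections (d + m) d ≡ d ! * completeHomogeneous m (interval 1 d)
surjections≡!*completeHomogeneous zero    zero    = refl
surjections≡!*completeHomogeneous zero    (suc m) = refl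
surjections≡!*completeHomogeneous (suc d) zero    = begin
  surjections (suc d + 0) (suc d)                    ≡⟨ cong (λ n → surjections n (suc d)) (+-identityʳ (suc d)) ⟩
  suc d * (surjections d (suc d) + surjections d d)  ≡⟨ cong₂ (λ u v → suc d * (u + v)) (surjections-< {d} ≤-refl) diagonal ⟩
  suc d * (d ! * 1)                                  ≡⟨ *-assoc (suc d) (d !) 1 ⟨
  suc d ! * 1                                        ∎
  where
  diagonal : surjections d d ≡ d ! * 1
  diagonal = trans (cong (λ n → surjections n d) (sym (+-identityʳ d))) (surjections≡!*completeHomogeneous d 0)
surjections≡!*completeHomogeneous (suc d) (suc m) = begin
  suc d * (surjections (d + suc m) (suc d) + surjections (d + suc m) d)
    ≡⟨ cong₂ (λ u v → suc d * (u + v))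
             (trans (cong (λ n → surjections n (suc d)) (+-suc d m)) (surjections≡!*completeHomogeneous (suc d) m))
             (surjections≡!*completeHomogeneous d (suc m)) ⟩
  suc d * (suc d * d ! * H m (interval 1 (suc d)) + d ! * H (suc m) (interval 1 d))
    ≡⟨ factor (suc d) (d !) (H m (interval 1 (suc d))) (H (suc m) (interval 1 d)) ⟩
  suc d ! * (suc d * H m (interval 1 (suc d)) + H (suc m) (interval 1 d))
    ≡⟨ cong (suc d ! *_) (completeHomogeneous-interval-last m 1 d) ⟨
  suc d ! * H (suc m) (interval 1 (suc d)) ∎
  where
  H = completeHomogeneous
  factor : ∀ B F X Y → B * (B * F * X + F * Y) ≡ B * F * (B * X + Y)
  factor = solve-∀

recurrence-solution : ∀ B (f g : ℕ → ℕ) → g 0 ≡ 0 → (∀ M → g (suc M) ≡ B * (g M + f M)) →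
  ∀ x M → sum (map (λ y → B ^ (y ∸ x) * f (x + M ∸ y)) (interval (suc x) M)) ≡ g M
recurrence-solution B f g g-zero g-suc x zero    = sym g-zero
recurrence-solution B f g g-zero g-suc x (suc M) = begin
  B ^ (suc x ∸ x) * f (x + suc M ∸ suc x) + sum (map (λ y → B ^ (y ∸ x) * f (x + suc M ∸ y)) (interval (suc (suc x)) M))
    ≡⟨ cong₂ _+_ first (cong sum (map-interval-cong (suc (suc x)) M shift)) ⟩
  B * f M + sum (map (λ y → B * (B ^ (y ∸ suc x) * f (suc x + M ∸ y))) (interval (suc (suc x)) M))
    ≡⟨ cong (B * f M +_) (sum-map-*ˡ B _ (interval (suc (suc x)) M)) ⟩
  B * f M + B * sum (map (λ y → B ^ (y ∸ suc x) * f (suc x + M ∸ y)) (interval (suc (suc x)) M))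
    ≡⟨ cong (λ s → B * f M + B * s) (recurrence-solution B f g g-zero g-suc (suc x) M) ⟩
  B * f M + B * g M   ≡⟨ +-comm (B * f M) (B * g M) ⟩
  B * g M + B * f M   ≡⟨ *-distribˡ-+ B (g M) (f M) ⟨
  B * (g M + f M)     ≡⟨ g-suc M ⟨
  g (suc M)           ∎
  where
  first : B ^ (suc x ∸ x) * f (x + suc M ∸ suc x) ≡ B * f M
  first = cong₂ _*_ (trans (cong (B ^_) (m+n∸n≡m 1 x)) (*-identityʳ B))
                    (cong f (trans (cong (_∸ suc x) (+-suc x M)) (m+n∸m≡n x M)))
  shift : ∀ y → suc (suc x) ≤ y → y < suc (suc x) + M →
          B ^ (y ∸ x) * f (x + suc M ∸ y) ≡ B * (B ^ (y ∸ suc x) * f (suc x + M ∸ y))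
  shift (suc y) (s≤s x<y) _ = trans (cong₂ (λ e z → B ^ e * f (z ∸ suc y)) (+-∸-assoc 1 (<⇒≤ x<y)) (+-suc x M))
                                    (*-assoc B _ _)

module LinkedSums {R : ℕ → ℕ → Set} (R? : ∀ x y → Dec (R x y)) (a b : ℕ) where

  linked? : ∀ xs → Dec (Linked.Linked R xs)
  linked? = Linked.linked? R?

  linkedSum : ℕ → ℕ → (List ℕ → ℕ) → ℕ
  linkedSum k x F = sum (map (λ t → if does (linked? (x ∷ t)) then F t else 0) (tuples k a b))

  linkedSum-suc : ∀ {k x} (F : List ℕ → ℕ) (w : ℕ → ℕ) (G : ℕ → List ℕ → ℕ) → (∀ y t → F (y ∷ t) ≡ w y * G y t) →
    linkedSum (suc k) x F ≡ sum (map (λ y → if does (R? x y) then w y * linkedSum k y (G y) else 0) (range a b))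
  linkedSum-suc {k} {x} F w G F≡ =
    trans (sum-tuples-suc _ k a b) (cong sum (map-cong inner-sum (range a b)))
    where
    inner-sum : ∀ y → sum (map (λ t → if does (R? x y) ∧ does (linked? (y ∷ t)) then F (y ∷ t) else 0) (tuples k a b))
                       ≡ (if does (R? x y) then w y * linkedSum k y (G y) else 0)
    inner-sum y = begin
      sum (map (λ t → if Rxy ∧ does (linked? (y ∷ t)) then F (y ∷ t) else 0) (tuples k a b))
        ≡⟨ cong sum (map-cong (λ t → trans (cong (λ v → if Rxy ∧ does (linked? (y ∷ t)) then v else 0) (F≡ y t))
                                           (if-∧-* Rxy _ (w y) (G y t))) (tuples k a b)) ⟩
      sum (map (λ t → if Rxy then w y * (if does (linked? (y ∷ t)) then G y t else 0) else 0) (tuples k a b))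
        ≡⟨ sum-map-if Rxy _ (tuples k a b) ⟩
      (if Rxy then sum (map (λ t → w y * (if does (linked? (y ∷ t)) then G y t else 0)) (tuples k a b)) else 0)
        ≡⟨ cong (λ s → if Rxy then s else 0) (sum-map-*ˡ (w y) _ (tuples k a b)) ⟩
      (if Rxy then w y * linkedSum k y (G y) else 0) ∎
      where Rxy = does (R? x y)

  sum-linked≡linkedSum : ∀ {x} k (F : List ℕ → ℕ) → (∀ {y} → a ≤ y → R x y) →
    sum (map (λ t → if does (linked? t) then F t else 0) (tuples k a b)) ≡ linkedSum k x F
  sum-linked≡linkedSum         zero    F xR = refl
  sum-linked≡linkedSum {x} (suc k) F xR = begin
    sum (map F' (tuples (suc k) a b))
      ≡⟨ sum-tuples-suc F' k a b ⟩
    sum (map (λ y → sum (map (λ t → F' (y ∷ t)) (tuples k a b))) (range a b))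
      ≡⟨ cong sum (map-range-cong a b (λ y a≤y → cong (guarded y) (sym (dec-true (R? x y) (xR a≤y))))) ⟩
    sum (map (λ y → sum (map (λ t → if does (linked? (x ∷ y ∷ t)) then F (y ∷ t) else 0) (tuples k a b))) (range a b))
      ≡⟨ sum-tuples-suc _ k a b ⟨
    linkedSum (suc k) x F ∎
    where
    F' : List ℕ → ℕ
    F' t = if does (linked? t) then F t else 0
    guarded : ℕ → Bool → ℕ
    guarded y r = sum (map (λ t → if r ∧ does (linked? (y ∷ t)) then F (y ∷ t) else 0) (tuples k a b))

module WeaklyIncreasing (d : ℕ) where
  open LinkedSums _≤?_ 1 d

  linkedSum-product : ∀ m x → 1 ≤ x → x ≤ suc d →
    linkedSum m x product ≡ completeHomogeneous m (interval x (suc d ∸ x))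
  linkedSum-product zero    x _ _ = refl
  linkedSum-product (suc m) x 1≤x x≤1+d = begin
    linkedSum (suc m) x product
      ≡⟨ linkedSum-suc {m} product (λ y → y) (λ _ → product) (λ _ _ → refl) ⟩
    sum (map (λ y → if does (x ≤? y) then y * linkedSum m y product else 0) (range 1 d))
      ≡⟨ cong (λ ys → sum (map (λ y → if does (x ≤? y) then y * linkedSum m y product else 0) ys)) (range≡interval 1 d) ⟩
    sum (map (λ y → if does (x ≤? y) then y * linkedSum m y product else 0) (interval 1 d))
      ≡⟨ cong sum (map-interval-cong 1 d (λ y 1≤y y<1+d →
           cong (λ v → if does (x ≤? y) then y * v else 0) (linkedSum-product m y 1≤y (<⇒≤ y<1+d)))) ⟩
    sum (map (λ y → if does (x ≤? y) then y * H m (interval y (suc d ∸ y)) else 0) (interval 1 d))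
      ≡⟨ sum-interval-if-≤ (λ y → y * H m (interval y (suc d ∸ y))) 1 d 1≤x ⟩
    sum (map (λ y → y * H m (interval y (suc d ∸ y))) (interval x (suc d ∸ x)))
      ≡⟨ cong (λ e → sum (map (λ y → y * H m (interval y (e ∸ y))) (interval x (suc d ∸ x)))) (m+[n∸m]≡n x≤1+d) ⟨
    sum (map (λ y → y * H m (interval y (x + (suc d ∸ x) ∸ y))) (interval x (suc d ∸ x)))
      ≡⟨ completeHomogeneous-interval-suffixes m x (suc d ∸ x) ⟨
    H (suc m) (interval x (suc d ∸ x)) ∎
    where H = completeHomogeneous

  sum-weakIncr-product : ∀ m → sum (map product (weakIncr m 1 d)) ≡ completeHomogeneous m (interval 1 d)
  sum-weakIncr-product m = begin
    sum (map product (weakIncr m 1 d))                                 ≡⟨ sum-filter (Linked.linked? _≤?_) product (tuples m 1 d) ⟩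
    sum (map (λ t → if does (linked? t) then product t else 0) (tuples m 1 d)) ≡⟨ sum-linked≡linkedSum m product (λ 1≤y → 1≤y) ⟩
    linkedSum m 1 product                                              ≡⟨ linkedSum-product m 1 ≤-refl (s≤s z≤n) ⟩
    completeHomogeneous m (interval 1 d)                               ∎

open WeaklyIncreasing using (sum-weakIncr-product)

lhs≡surjections : ∀ {n d} → d ≤ n → lhs n d ≡ surjections n d
lhs≡surjections {n} {d} d≤n with m≤n⇒∃[o]m+o≡n d≤n
... | m , refl = begin
  d ! * sum (map product (weakIncr (d + m ∸ d) 1 d))  ≡⟨ cong (λ k → d ! * sum (map product (weakIncr k 1 d))) (m+n∸m≡n d m) ⟩
  d ! * sum (map product (weakIncr m 1 d))            ≡⟨ cong (d ! *_) (sum-weakIncr-product d m) ⟩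
  d ! * completeHomogeneous m (interval 1 d)           ≡⟨ surjections≡!*completeHomogeneous d m ⟨
  surjections (d + m) d                                ∎

-- rhsTerm d with j₀ taken from the head of ks instead of 0 (jAt ks (suc i) plays the role of j_i).
chainTerm : ℕ → List ℕ → ℕ
chainTerm d ks = product (map (λ r → r ^ (jAt ks (suc (suc (d ∸ r))) ∸ jAt ks (suc (d ∸ r)))) (range 2 d))

jAt-0∷ : ∀ js i → jAt js i ≡ jAt (0 ∷ js) (suc i)
jAt-0∷ js zero    = refl
jAt-0∷ js (suc i) = refl

rhsTerm≡chainTerm : ∀ d js → rhsTerm d js ≡ chainTerm d (0 ∷ js)
rhsTerm≡chainTerm d js =
  cong product (map-cong (λ r → cong₂ (λ u v → r ^ (u ∸ v)) (cong (jAt js) (+-comm (d ∸ r) 1)) (jAt-0∷ js (d ∸ r))) (range 2 d))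

chainTerm-∷ : ∀ d x y t → chainTerm (suc (suc d)) (x ∷ y ∷ t) ≡ suc (suc d) ^ (y ∸ x) * chainTerm (suc d) (y ∷ t)
chainTerm-∷ d x y t = begin
  product (map f (range 2 (suc (suc d))))            ≡⟨ cong (λ rs → product (map f rs)) (range≡interval 2 (suc (suc d))) ⟩
  product (map f (interval 2 (suc d)))               ≡⟨ cong (λ rs → product (map f rs)) (interval-∷ʳ 2 d) ⟩
  product (map f (interval 2 d ∷ʳ (2 + d)))          ≡⟨ product-map-∷ʳ f (interval 2 d) (2 + d) ⟩
  product (map f (interval 2 d)) * f (2 + d)         ≡⟨ cong₂ _*_ (cong product (map-interval-cong 2 d shift)) last ⟩
  product (map g (interval 2 d)) * D ^ (y ∸ x)       ≡⟨ *-comm _ (D ^ (y ∸ x)) ⟩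
  D ^ (y ∸ x) * product (map g (interval 2 d))       ≡⟨ cong (λ rs → D ^ (y ∸ x) * product (map g rs)) (range≡interval 2 (suc d)) ⟨
  D ^ (y ∸ x) * chainTerm (suc d) (y ∷ t)            ∎
  where
  D = suc (suc d)
  f g : ℕ → ℕ
  f r = r ^ (jAt (x ∷ y ∷ t) (suc (suc (D ∸ r))) ∸ jAt (x ∷ y ∷ t) (suc (D ∸ r)))
  g r = r ^ (jAt (y ∷ t) (suc (suc (suc d ∸ r))) ∸ jAt (y ∷ t) (suc (suc d ∸ r)))
  shift : ∀ r → 2 ≤ r → r < 2 + d → f r ≡ g r
  shift r _ r<2+d = cong (λ i → r ^ (jAt (x ∷ y ∷ t) (suc (suc i)) ∸ jAt (x ∷ y ∷ t) (suc i))) (+-∸-assoc 1 (s≤s⁻¹ r<2+d))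
  last : f (2 + d) ≡ D ^ (y ∸ x)
  last = cong (λ i → D ^ (jAt (x ∷ y ∷ t) (suc (suc i)) ∸ jAt (x ∷ y ∷ t) (suc i))) (n∸n≡0 d)

module StrictlyIncreasing (N : ℕ) where
  open LinkedSums _<?_ 1 N

  linkedSum-chainTerm : ∀ k x → x ≤ N →
    linkedSum k x (λ t → chainTerm (suc k) (x ∷ t)) ≡ surjections (suc (N ∸ x)) (suc k)
  linkedSum-chainTerm zero    x _   = sym (surjections-onto-1 (N ∸ x))
  linkedSum-chainTerm (suc k) x x≤N = begin
    linkedSum (suc k) x (λ t → chainTerm (suc (suc k)) (x ∷ t))
      ≡⟨ linkedSum-suc {k} _ (λ y → B ^ (y ∸ x)) (λ y t → chainTerm (suc k) (y ∷ t)) (chainTerm-∷ k x) ⟩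
    sum (map (λ y → if does (x <? y) then B ^ (y ∸ x) * linkedSum k y (λ t → chainTerm (suc k) (y ∷ t)) else 0) (range 1 N))
      ≡⟨ cong (λ ys → sum (map linkedStep ys)) (range≡interval 1 N) ⟩
    sum (map linkedStep (interval 1 N))
      ≡⟨ cong sum (map-interval-cong 1 N (λ y _ y<1+N →
           cong (λ v → if does (x <? y) then B ^ (y ∸ x) * v else 0) (linkedSum-chainTerm k y (s≤s⁻¹ y<1+N)))) ⟩
    sum (map (λ y → if does (suc x ≤? y) then summand y else 0) (interval 1 N))
      ≡⟨ sum-interval-if-≤ summand 1 N (s≤s z≤n) ⟩
    sum (map summand (interval (suc x) (N ∸ x)))
      ≡⟨ cong (λ z → sum (map (λ y → B ^ (y ∸ x) * surjections (suc (z ∸ y)) (suc k)) (interval (suc x) (N ∸ x))))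
              (m+[n∸m]≡n x≤N) ⟨
    sum (map (λ y → B ^ (y ∸ x) * surjections (suc (x + (N ∸ x) ∸ y)) (suc k)) (interval (suc x) (N ∸ x)))
      ≡⟨ recurrence-solution B (λ M → surjections (suc M) (suc k)) (λ M → surjections (suc M) B)
                             (*-zeroʳ B) (λ _ → refl) x (N ∸ x) ⟩
    surjections (suc (N ∸ x)) B ∎
    where
    B = suc (suc k)
    linkedStep : ℕ → ℕ
    linkedStep y = if does (x <? y) then B ^ (y ∸ x) * linkedSum k y (λ t → chainTerm (suc k) (y ∷ t)) else 0
    summand : ℕ → ℕ
    summand y = B ^ (y ∸ x) * surjections (suc (N ∸ y)) (suc k)

  sum-strictIncr-rhsTerm : ∀ e → sum (map (rhsTerm (suc e)) (strictIncr e 1 N)) ≡ surjections (suc N) (suc e)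
  sum-strictIncr-rhsTerm e = begin
    sum (map (rhsTerm (suc e)) (strictIncr e 1 N))
      ≡⟨ sum-filter (Linked.linked? _<?_) (rhsTerm (suc e)) (tuples e 1 N) ⟩
    sum (map (λ t → if does (linked? t) then rhsTerm (suc e) t else 0) (tuples e 1 N))
      ≡⟨ cong sum (map-cong (λ t → cong (λ v → if does (linked? t) then v else 0) (rhsTerm≡chainTerm (suc e) t)) (tuples e 1 N)) ⟩
    sum (map (λ t → if does (linked? t) then chainTerm (suc e) (0 ∷ t) else 0) (tuples e 1 N))
      ≡⟨ sum-linked≡linkedSum e _ (λ 1≤y → 1≤y) ⟩
    linkedSum e 0 (λ t → chainTerm (suc e) (0 ∷ t))
      ≡⟨ linkedSum-chainTerm e 0 z≤n ⟩
    surjections (suc N) (suc e) ∎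

open StrictlyIncreasing using (sum-strictIncr-rhsTerm)

mainTheorem3 : (n d : ℕ) → 1 ≤ d → d ≤ n → lhs n d ≡ rhs n d
mainTheorem3 (suc n) (suc e) _ d≤n = begin
  lhs (suc n) (suc e)          ≡⟨ lhs≡surjections d≤n ⟩
  surjections (suc n) (suc e)  ≡⟨ sum-strictIncr-rhsTerm n e ⟨
  rhs (suc n) (suc e)          ∎
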